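{- None of the set-functions $\Downarrow$, $\mathrm{Max}$, $\mathrm{Card}$ is $(\mathcal{U},\mathcal{P})$-definable.
   Context: $\mathbb{N}=\{0,1,2,\ldots\}$, $2^{\mathbb{N}}$ is its power set. A set-function is a map $(2^{\mathbb{N}})^k\to 2^{\mathbb{N}}$ for some $k\ge 0$. For a collection $\mathcal{O}$ of set-functions, $\mathcal{O}$-circuits are terms built from variables ranging over $2^{\mathbb{N}}$, the constants $\emptyset$, $\mathbb{N}$, $\{n\}$ ($n\in\mathbb{N}$), the operations $\cup$, $\cap$, complement relative to $\mathbb{N}$, and the functions in $\mathcal{O}$. A circuit $\tau(x_1,\ldots,x_n)$ with $n\ge1$ variables defines the function $(s_1,\ldots,s_n)\mapsto\tau(s_1,\ldots,s_n)$ obtained by evaluation; a set-function is $\mathcal{O}$-definable if some $\mathcal{O}$-circuit defines it; "$(\mathcal{O}_1,\mathcal{O}_2)$-definable" means $(\mathcal{O}_1\cup\mathcal{O}_2)$-definable. For $s\subseteq\mathbb{N}$, $s_{|m}=s\cap\{0,\ldots,m\}$, applied componentwise to tuples. A set-function $F$ of arity $n$ is continuous at $\vec s$ if for every $m$ there is $n'$ such that for all $\vec t$, $\vec t_{|n'}=\vec s_{|n'}$ implies $F(\vec t)_{|m}=F(\vec s)_{|m}$. $\mathcal{U}$ is the collection of all set-functions (of all arities) continuous at every point; $\mathcal{P}$ is the collection of all predicates, i.e. set-functions (of all arities) whose values all lie in $\{\emptyset,\{0\}\}$. The functions are: $\Downarrow(x)=\{m\in\mathbb{N}\mid \exists n\in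 x,\ m\le n\}$; $\mathrm{Max}(x)=\emptyset$ if $x=\emptyset$, $\mathbb{N}$ if $x$ is infinite, $\{\max x\}$ otherwise; $\mathrm{Card}(x)=\{|x|\}$ if $x$ is finite and $\mathbb{N}$ otherwise. -}

module Defs where

open import Data.Nat using (ℕ; zero; suc; _≤_; _<_; _≟_)
open import Data.Bool using (Bool; true; false; _∨_; _∧_; not; if_then_else_)
open import Data.Fin using (Fin)
open import Data.Product using (Σ; ∃; _×_; _,_)
open import Data.Sum using (_⊎_)
open import Relation.Nullary using (¬_; does)
open import Relation.Binary.PropositionalEquality using (_≡_)

Subset : Set
Subset = ℕ → Bool

SetFun : ℕ → Set
SetFun k = (Fin k → Subset) → Subset

Collection : Set₁
Collection = (k : ℕ) → SetFun k → Set

∅ˢ : Subset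
∅ˢ _ = false

ℕˢ : Subset
ℕˢ _ = true

singleton : ℕ → Subset
singleton n m = does (m ≟ n)

_∪ˢ_ : Subset → Subset → Subset
(s ∪ˢ t) m = s m ∨ t m

_∩ˢ_ : Subset → Subset → Subset
(s ∩ˢ t) m = s m ∧ t m

∁ˢ : Subset → Subset
∁ˢ s m = not (s m)

_∪ᶜ_ : Collection → Collection → Collection
(O₁ ∪ᶜ O₂) k F = O₁ k F ⊎ O₂ k F

data Circuit (O : Collection) (n : ℕ) : Set where
  var    : Fin n → Circuit O n
  empty  : Circuit O n
  full   : Circuit O n
  single : ℕ → Circuit O n
  union  : Circuit O n → Circuit O n → Circuit O n
  inter  : Circuit O n → Circuit O n → Circuit O n
  compl  : Circuit O n → Circuit O n
  app    : (k : ℕ) (F : SetFun k) → O k F → (Fin k → Circuit O n) → Circuit O n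

eval : {O : Collection} {n : ℕ} → Circuit O n → (Fin n → Subset) → Subset
eval (var i) ρ = ρ i
eval empty ρ = ∅ˢ
eval full ρ = ℕˢ
eval (single k) ρ = singleton k
eval (union a b) ρ = eval a ρ ∪ˢ eval b ρ
eval (inter a b) ρ = eval a ρ ∩ˢ eval b ρ
eval (compl a) ρ = ∁ˢ (eval a ρ)
eval (app k F _ args) ρ = F (λ i → eval (args i) ρ)

AgreeUpTo : {k : ℕ} → ℕ → (Fin k → Subset) → (Fin k → Subset) → Set
AgreeUpTo m s t = ∀ i j → j ≤ m → s i j ≡ t i j

ContinuousAt : {k : ℕ} → SetFun k → (Fin k → Subset) → Set
ContinuousAt F s =
  ∀ m → ∃ λ n′ → ∀ t → AgreeUpTo n′ t s → ∀ j → j ≤ m → F t j ≡ F s j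

𝒰 : Collection
𝒰 k F = ∀ s → ContinuousAt F s

-- 𝒫 : predicates, i.e. all values lie in {∅, {0}}.
𝒫 : Collection
𝒫 k F = ∀ s j → 1 ≤ j → F s j ≡ false

Finite : Subset → Set
Finite x = ∃ λ N → ∀ n → N ≤ n → x n ≡ false

countBelow : Subset → ℕ → ℕ
countBelow x zero = zero
countBelow x (suc N) = (if x N then suc else λ c → c) (countBelow x N)

-- Graphs of the three set-functions: IsF x y means "y = F(x)".
Is⇓ : Subset → Subset → Set
Is⇓ x y = ∀ m → (y m ≡ true → ∃ λ n → x n ≡ true × m ≤ n)
              × ((∃ λ n → x n ≡ true × m ≤ n) → y m ≡ true)

IsMax : Subset → Subset → Set
IsMax x y =
    ((∀ n → x n ≡ false) → ∀ m → y m ≡ false)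
  × (¬ Finite x → ∀ m → y m ≡ true)
  × (∀ k → x k ≡ true → (∀ n → x n ≡ true → n ≤ k) → ∀ m → y m ≡ singleton k m)

IsCard : Subset → Subset → Set
IsCard x y =
    (¬ Finite x → ∀ m → y m ≡ true)
  × (∀ N → (∀ n → N ≤ n → x n ≡ false) → ∀ m → y m ≡ singleton (countBelow x N) m)

Definable₁ : Collection → (Subset → Subset → Set) → Set
Definable₁ O G = Σ (Circuit O 1) λ τ → ∀ x → G x (eval τ (λ _ → x))

module Submission where

-- Call a set-function piecewise continuous if its inputs can be split
-- into finitely many pieces such that it is continuous within each piece.
-- Continuous functions have one piece, a predicate has two (decided by whether
-- its value contains 0), the Boolean operations are continuous, and
-- substitution of piecewise continuous functions into a piecewise continuous
-- function is again piecewise continuous.  Hence every function defined by a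
-- (𝒰 ∪ 𝒫)-circuit is piecewise continuous.
--
-- For a unary piecewise continuous f we build a chain of finite sets
-- X 0 ⊂ X 1 ⊂ …, where X (i+1) adds a new maximum M (i+1) beyond the modulus of
-- continuity of f at X i.  By pigeonhole two stages i < j lie in the same piece,
-- and as X j agrees with X i up to that modulus, f X j and f X i agree on
-- {0,…,M i + 1}.  But ⇓, Max and Card all distinguish X i from X j there: at
-- M i + 1, at M i and at i + 1 respectively.

open import Defs
open import Data.Bool using (Bool; true; false; _∨_; _∧_; not; if_then_else_)
open import Data.Bool.Properties using (∨-zeroʳ; ∨-identityʳ; T-≡)
open import Data.Empty using (⊥)
open import Data.Fin using (Fin; combine; toℕ) renaming (zero to fzero; suc to fsuc)
open import Data.Fin.Properties using (combine-injective; pigeonhole; 2↔Bool)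
open import Data.Nat using (ℕ; zero; suc; _≤_; _<_; _≤′_; _⊔_; _*_; _≟_; z≤n; s≤s; ≤′-refl; ≤′-step)
open import Data.Nat.Properties
  using (≤-refl; ≤-reflexive; ≤-trans; <-trans; ≤-<-trans; <⇒≤; <⇒≢; <⇒≱; n<1+n; n≤1+n; ≡ᵇ⇒≡; m≤m⊔n; m≤n⊔m; ≤⇒≤′; ≤′⇒≤)
open import Data.Product using (_×_; ∃; ∃₂; _,_; proj₁; proj₂)
open import Data.Sum using (inj₁; inj₂)
open import Data.Vec.Functional using ([]; _∷_)
open import Function using (id)
open import Function.Bundles using (Inverse; Equivalence)
open import Relation.Nullary using (¬_; contradiction)
open import Relation.Nullary.Decidable using (dec-true; dec-false)
open import Relation.Binary.PropositionalEquality using (_≡_; _≢_; refl; sym; trans; cong; cong₂; module ≡-Reasoning)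

singleton-self : ∀ c → singleton c c ≡ true
singleton-self c = dec-true (c ≟ c) refl

singleton-other : ∀ {c n} → n ≢ c → singleton c n ≡ false
singleton-other {c} {n} = dec-false (n ≟ c)

singleton-true : ∀ {c n} → singleton c n ≡ true → n ≡ c
singleton-true {c} {n} e = ≡ᵇ⇒≡ n c (Equivalence.from T-≡ e)

true≢false : ∀ {a b} → a ≡ true → b ≡ false → a ≢ b
true≢false refl refl ()

countBelow-member : ∀ {x N} → x N ≡ true → countBelow x (suc N) ≡ suc (countBelow x N)
countBelow-member xN rewrite xN = refl

countBelow-cong : ∀ {x y} N → (∀ n → n < N → x n ≡ y n) → countBelow x N ≡ countBelow y N
countBelow-cong zero _ = refl
countBelow-cong (suc N) x≗y =
  cong₂ (λ b c → (if b then suc else id) c) (x≗y N ≤-refl)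
        (countBelow-cong N (λ n n<N → x≗y n (<-trans n<N (n<1+n N))))

countBelow-stable : ∀ {x B C} → (∀ n → B ≤ n → x n ≡ false) → B ≤′ C →
                    countBelow x C ≡ countBelow x B
countBelow-stable _ ≤′-refl = refl
countBelow-stable {C = suc C} vanish (≤′-step B≤′C) rewrite vanish C (≤′⇒≤ B≤′C) =
  countBelow-stable vanish B≤′C

upperBound : ∀ {k} (r : Fin k → ℕ) → ∃ λ B → ∀ i → r i ≤ B
upperBound {zero} r = 0 , λ ()
upperBound {suc k} r with upperBound (λ i → r (fsuc i))
... | B , bound = r fzero ⊔ B , below
  where
  below : ∀ i → r i ≤ r fzero ⊔ B
  below fzero = m≤m⊔n (r fzero) B
  below (fsuc i) = ≤-trans (bound i) (m≤n⊔m (r fzero) B)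

record JointLabelling (A : Set) {k : ℕ} (size : Fin k → ℕ)
                      (label : ∀ i → A → Fin (size i)) : Set where
  field
    jointSize  : ℕ
    jointLabel : A → Fin jointSize
    refines    : ∀ {a b} → jointLabel a ≡ jointLabel b → ∀ i → label i a ≡ label i b

jointLabelling : ∀ {A : Set} {k} (size : Fin k → ℕ) (label : ∀ i → A → Fin (size i)) →
                 JointLabelling A size label
jointLabelling {k = zero} size label = record
  { jointSize = 1 ; jointLabel = λ _ → fzero ; refines = λ _ () }
jointLabelling {k = suc k} size label = record
  { jointSize = size fzero * jointSize
  ; jointLabel = λ a → combine (label fzero a) (jointLabel a)
  ; refines = refines′
  }
  where
  open JointLabelling (jointLabelling (λ i → size (fsuc i)) (λ i → label (fsuc i)))
  refines′ : ∀ {a b} → combine (label fzero a) (jointLabel a) ≡ combine (label fzero b) (jointLabel b) →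
             ∀ i → label i a ≡ label i b
  refines′ {a} {b} e fzero = proj₁ (combine-injective (label fzero a) _ (label fzero b) _ e)
  refines′ {a} {b} e (fsuc i) = refines (proj₂ (combine-injective (label fzero a) _ (label fzero b) _ e)) i

AgreeUpTo-mono : ∀ {k a b} {s t : Fin k → Subset} → a ≤ b → AgreeUpTo b s t → AgreeUpTo a s t
AgreeUpTo-mono a≤b agree i j j≤a = agree i j (≤-trans j≤a a≤b)

record PiecewiseContinuous {k : ℕ} (F : SetFun k) : Set where
  field
    pieces     : ℕ
    piece      : (Fin k → Subset) → Fin pieces
    continuous : ∀ s m → ∃ λ n′ → ∀ t → AgreeUpTo n′ t s → piece t ≡ piece s →
                 ∀ j → j ≤ m → F t j ≡ F s j

continuous⇒piecewise : ∀ {k} {F : SetFun k} → 𝒰 k F → PiecewiseContinuous F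
continuous⇒piecewise F-continuous = record
  { pieces = 1
  ; piece = λ _ → fzero
  ; continuous = λ s m → proj₁ (F-continuous s m) , λ t agree _ → proj₂ (F-continuous s m) t agree
  }

-- A predicate is continuous on each of the two pieces {F = ∅} and {F = {0}}.
predicate⇒piecewise : ∀ {k} {F : SetFun k} → 𝒫 k F → PiecewiseContinuous F
predicate⇒piecewise {F = F} F-predicate = record
  { pieces = 2
  ; piece = λ s → from (F s 0)
  ; continuous = λ s m → 0 , λ t _ samePiece j _ → sameValue s t samePiece j
  }
  where
  open Inverse 2↔Bool using (to; from; strictlyInverseˡ)
  sameValue : ∀ s t → from (F t 0) ≡ from (F s 0) → ∀ j → F t j ≡ F s j
  sameValue s t samePiece zero =
    trans (sym (strictlyInverseˡ (F t 0))) (trans (cong to samePiece) (strictlyInverseˡ (F s 0)))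
  sameValue s t _ (suc j) = trans (F-predicate t (suc j) (s≤s z≤n)) (sym (F-predicate s (suc j) (s≤s z≤n)))

-- Substitution preserves piecewise continuity: the pieces of the composite are
-- the joint pieces of the arguments, refined by the piece of the outer function.
compose : ∀ {k n} {G : SetFun k} {F : Fin k → SetFun n} →
          PiecewiseContinuous G → (∀ i → PiecewiseContinuous (F i)) →
          PiecewiseContinuous (λ ρ → G (λ i → F i ρ))
compose {k} {n} {G} {F} PG PF = record
  { pieces = pieces PG * jointSize
  ; piece = λ ρ → combine (piece PG (args ρ)) (jointLabel ρ)
  ; continuous = continuity
  }
  where
  open PiecewiseContinuous
  args : (Fin n → Subset) → Fin k → Subset
  args ρ i = F i ρ
  open JointLabelling (jointLabelling (λ i → pieces (PF i)) (λ i → piece (PF i)))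

  continuity : ∀ ρ m → ∃ λ n′ → ∀ σ → AgreeUpTo n′ σ ρ →
               combine (piece PG (args σ)) (jointLabel σ) ≡ combine (piece PG (args ρ)) (jointLabel ρ) →
               ∀ j → j ≤ m → G (args σ) j ≡ G (args ρ) j
  continuity ρ m = proj₁ bound , λ σ agree samePiece →
      let (sameOuter , sameInner) = combine-injective _ _ _ _ samePiece
      in proj₂ outer (args σ) (argsAgree σ agree (refines sameInner)) sameOuter
    where
    outer : ∃ λ n′ → ∀ t → AgreeUpTo n′ t (args ρ) → piece PG t ≡ piece PG (args ρ) →
            ∀ j → j ≤ m → G t j ≡ G (args ρ) j
    outer = continuous PG (args ρ) m
    inner : ∀ i → ∃ λ r → ∀ σ → AgreeUpTo r σ ρ → piece (PF i) σ ≡ piece (PF i) ρ →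
            ∀ j → j ≤ proj₁ outer → F i σ j ≡ F i ρ j
    inner i = continuous (PF i) ρ (proj₁ outer)
    bound : ∃ λ B → ∀ i → proj₁ (inner i) ≤ B
    bound = upperBound (λ i → proj₁ (inner i))
    argsAgree : ∀ σ → AgreeUpTo (proj₁ bound) σ ρ → (∀ i → piece (PF i) σ ≡ piece (PF i) ρ) →
                AgreeUpTo (proj₁ outer) (args σ) (args ρ)
    argsAgree σ agree samePieces i = proj₂ (inner i) σ (AgreeUpTo-mono (proj₂ bound i) agree) (samePieces i)

projection-continuous : ∀ {n} (i : Fin n) → 𝒰 n (λ ρ → ρ i)
projection-continuous i ρ m = m , λ σ agree → agree i

constant-continuous : ∀ {n} (c : Subset) → 𝒰 n (λ _ → c)
constant-continuous c ρ m = 0 , λ _ _ _ _ → refl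

unary-continuous : (op : Bool → Bool) → 𝒰 1 (λ s j → op (s fzero j))
unary-continuous op s m = m , λ t agree j j≤m → cong op (agree fzero j j≤m)

binary-continuous : (op : Bool → Bool → Bool) → 𝒰 2 (λ s j → op (s fzero j) (s (fsuc fzero) j))
binary-continuous op s m = m , λ t agree j j≤m →
  cong₂ op (agree fzero j j≤m) (agree (fsuc fzero) j j≤m)

unary : ∀ {n} {f : SetFun n} (op : Bool → Bool) →
        PiecewiseContinuous f → PiecewiseContinuous (λ ρ j → op (f ρ j))
unary {f = f} op Pf = compose {F = λ _ → f} (continuous⇒piecewise (unary-continuous op)) (λ _ → Pf)

binary : ∀ {n} {f g : SetFun n} (op : Bool → Bool → Bool) →
         PiecewiseContinuous f → PiecewiseContinuous g →
         PiecewiseContinuous (λ ρ j → op (f ρ j) (g ρ j))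
binary {f = f} {g} op Pf Pg =
  compose {F = f ∷ g ∷ []} (continuous⇒piecewise (binary-continuous op))
          (λ { fzero → Pf ; (fsuc fzero) → Pg })

definable⇒piecewise : ∀ {n} (τ : Circuit (𝒰 ∪ᶜ 𝒫) n) → PiecewiseContinuous (eval τ)
definable⇒piecewise (var i) = continuous⇒piecewise (projection-continuous i)
definable⇒piecewise empty = continuous⇒piecewise (constant-continuous ∅ˢ)
definable⇒piecewise full = continuous⇒piecewise (constant-continuous ℕˢ)
definable⇒piecewise (single c) = continuous⇒piecewise (constant-continuous (singleton c))
definable⇒piecewise (union a b) = binary _∨_ (definable⇒piecewise a) (definable⇒piecewise b)
definable⇒piecewise (inter a b) = binary _∧_ (definable⇒piecewise a) (definable⇒piecewise b)
definable⇒piecewise (compl a) = unary not (definable⇒piecewise a)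
definable⇒piecewise (app k F (inj₁ F-continuous) args) =
  compose (continuous⇒piecewise F-continuous) (λ i → definable⇒piecewise (args i))
definable⇒piecewise (app k F (inj₂ F-predicate) args) =
  compose (predicate⇒piecewise F-predicate) (λ i → definable⇒piecewise (args i))

⟨_⟩ : Subset → Fin 1 → Subset
⟨ x ⟩ _ = x

module Chain {f : SetFun 1} (P : PiecewiseContinuous f) where
  open PiecewiseContinuous P

  -- Stage i is the finite set X i with maximum M i; R i is a modulus of
  -- continuity of f at X i (within its piece) for precision M i + 1.
  X : ℕ → Subset
  M : ℕ → ℕ
  R : ℕ → ℕ

  X zero = singleton 0
  X (suc i) = X i ∪ˢ singleton (M (suc i))
  M zero = 0
  M (suc i) = suc (M i ⊔ R i)
  R i = proj₁ (continuous ⟨ X i ⟩ (suc (M i)))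

  top-member : ∀ i → X i (M i) ≡ true
  top-member zero = refl
  top-member (suc i) = trans (cong (X i (M (suc i)) ∨_) (singleton-self (M (suc i)))) (∨-zeroʳ _)

  top-grows : ∀ i → M i < M (suc i)
  top-grows i = s≤s (m≤m⊔n (M i) (R i))

  below-top : ∀ i {n} → X i n ≡ true → n ≤ M i
  below-top zero member = ≤-reflexive (singleton-true member)
  below-top (suc i) {n} member with X i n in old
  ... | true = ≤-trans (below-top i old) (<⇒≤ (top-grows i))
  ... | false = ≤-reflexive (singleton-true member)

  above-top : ∀ i {n} → M i < n → X i n ≡ false
  above-top i {n} M<n with X i n in member
  ... | true = contradiction (below-top i member) (<⇒≱ M<n)
  ... | false = refl

  beyond : ∀ {i j} → i < j → M i ⊔ R i < M j
  beyond {i} i<j = go (≤⇒≤′ i<j)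
    where
    go : ∀ {j} → suc i ≤′ j → M i ⊔ R i < M j
    go ≤′-refl = ≤-refl
    go (≤′-step {j} i<′j) = <-trans (go i<′j) (top-grows j)

  top-increasing : ∀ {i j} → i < j → M i < M j
  top-increasing i<j = ≤-<-trans (m≤m⊔n _ _) (beyond i<j)

  stage≤top : ∀ i → i ≤ M i
  stage≤top zero = z≤n
  stage≤top (suc i) = ≤-trans (s≤s (stage≤top i)) (top-grows i)

  extend : ∀ j {n} → n < M (suc j) → X (suc j) n ≡ X j n
  extend j {n} n<M = trans (cong (X j n ∨_) (singleton-other (<⇒≢ n<M))) (∨-identityʳ _)

  stable : ∀ {i j n} → i < j → n ≤ M i ⊔ R i → X j n ≡ X i n
  stable {i} {n = n} i<j n≤ = go (≤⇒≤′ i<j)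
    where
    go : ∀ {j} → suc i ≤′ j → X j n ≡ X i n
    go ≤′-refl = extend i (≤-<-trans n≤ (beyond ≤-refl))
    go (≤′-step {j} i<′j) = trans (extend j (≤-<-trans n≤ (beyond (≤′⇒≤ (≤′-step i<′j))))) (go i<′j)

  card : ∀ i → countBelow (X i) (suc (M i)) ≡ suc i
  card zero = refl
  card (suc i) = begin
    countBelow (X (suc i)) (suc (M (suc i)))  ≡⟨ countBelow-member {X (suc i)} (top-member (suc i)) ⟩
    suc (countBelow (X (suc i)) (M (suc i)))  ≡⟨ cong suc (countBelow-cong (M (suc i)) (λ n → extend i)) ⟩
    suc (countBelow (X i) (M (suc i)))        ≡⟨ cong suc (countBelow-stable (λ n → above-top i) (≤⇒≤′ (top-grows i))) ⟩
    suc (countBelow (X i) (suc (M i)))        ≡⟨ cong suc (card i) ⟩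
    suc (suc i)                               ∎
    where open ≡-Reasoning

  -- Two of the stages X 0, …, X pieces lie in the same piece, so f cannot
  -- tell them apart up to precision M i + 1.
  collision : ∃₂ λ i j → i < j × (∀ p → p ≤ suc (M i) → f ⟨ X j ⟩ p ≡ f ⟨ X i ⟩ p)
  collision with pigeonhole (n<1+n pieces) (λ i → piece ⟨ X (toℕ i) ⟩)
  ... | i , j , i<j , samePiece =
    toℕ i , toℕ j , i<j , proj₂ (continuous ⟨ X (toℕ i) ⟩ _) ⟨ X (toℕ j) ⟩ agree (sym samePiece)
    where
    agree : AgreeUpTo (R (toℕ i)) ⟨ X (toℕ j) ⟩ ⟨ X (toℕ i) ⟩
    agree _ n n≤R = stable i<j (≤-trans n≤R (m≤n⊔m _ _))

  cannot-separate : (∀ {i j} → i < j → ∃ λ p → p ≤ suc (M i) × f ⟨ X j ⟩ p ≢ f ⟨ X i ⟩ p) → ⊥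
  cannot-separate separate =
    let (i , j , i<j , agree) = collision
        (p , p≤ , differ) = separate i<j
    in differ (agree p p≤)

-- ⇓(X i) stops at M i, while ⇓(X j) contains M j > M i.
⇓-undefinable : ¬ Definable₁ (𝒰 ∪ᶜ 𝒫) Is⇓
⇓-undefinable (τ , graph) =
  cannot-separate λ {i} {j} i<j → suc (M i) , ≤-refl , true≢false (late i<j) (early i)
  where
  open Chain (definable⇒piecewise τ)
  late : ∀ {i j} → i < j → eval τ ⟨ X j ⟩ (suc (M i)) ≡ true
  late {i} {j} i<j =
    proj₂ (graph (X j) (suc (M i))) (M j , top-member j , top-increasing i<j)
  early : ∀ i → eval τ ⟨ X i ⟩ (suc (M i)) ≡ false
  early i with eval τ ⟨ X i ⟩ (suc (M i)) in value
  ... | false = refl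
  ... | true with proj₁ (graph (X i) (suc (M i))) value
  ...   | n , member , M<n = contradiction (below-top i member) (<⇒≱ M<n)

-- Max(X i) = {M i} contains M i, while Max(X j) = {M j} does not.
Max-undefinable : ¬ Definable₁ (𝒰 ∪ᶜ 𝒫) IsMax
Max-undefinable (τ , graph) =
  cannot-separate λ {i} {j} i<j → M i , n≤1+n (M i) , λ e →
    true≢false (value i (singleton-self (M i))) (value j (singleton-other (<⇒≢ (top-increasing i<j)))) (sym e)
  where
  open Chain (definable⇒piecewise τ)
  value : ∀ k {m b} → singleton (M k) m ≡ b → eval τ ⟨ X k ⟩ m ≡ b
  value k {m} e = trans (proj₂ (proj₂ (graph (X k))) (M k) (top-member k) (λ n → below-top k) m) e

-- Card(X i) = {i + 1}, while Card(X j) = {j + 1}.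
Card-undefinable : ¬ Definable₁ (𝒰 ∪ᶜ 𝒫) IsCard
Card-undefinable (τ , graph) =
  cannot-separate λ {i} {j} i<j → suc i , s≤s (stage≤top i) , λ e →
    true≢false (value i (singleton-self (suc i))) (value j (singleton-other (<⇒≢ (s≤s i<j)))) (sym e)
  where
  open Chain (definable⇒piecewise τ)
  value : ∀ k {m b} → singleton (suc k) m ≡ b → eval τ ⟨ X k ⟩ m ≡ b
  value k {m} e = trans (proj₂ (graph (X k)) (suc (M k)) (λ n → above-top k) m)
                        (trans (cong (λ c → singleton c m) (card k)) e)

theorem3 : ¬ Definable₁ (𝒰 ∪ᶜ 𝒫) Is⇓
         × ¬ Definable₁ (𝒰 ∪ᶜ 𝒫) IsMax
         × ¬ Definable₁ (𝒰 ∪ᶜ 𝒫) IsCard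
theorem3 = ⇓-undefinable , Max-undefinable , Card-undefinable
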